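{- Let $t\to_{p(m\mapsto \mathsf{0})} u$ and $t\to_{p(m\mapsto \mathsf{1})} v$ for some $m\notin\mathrm{dom}(p)$. If $u$ and $v$ are syntactically identical then $t\to_p u$; otherwise, $t$ has the form $\mathbb{E}[\mathsf{f}\,\overline{m}]$.
   Context: A condition $p$ is (the graph of) a finite partial function from $\mathbb{N}$ to $\{\mathsf{0},\mathsf{1}\}$; for $m\notin\mathrm{dom}(p)$, $p(m\mapsto b)$ denotes $p\cup\{(m,b)\}$. The term language is that of Martin-Löf type theory with $\mathsf{N},\mathsf{N}_0,\mathsf{N}_1,\mathsf{N}_2$, $\Pi$, $\Sigma$, a universe, recursors $\mathsf{rec}_{\mathsf{N}_0},\mathsf{rec}_{\mathsf{N}_1},\mathsf{rec}_{\mathsf{N}_2},\mathsf{rec}_{\mathsf{N}}$, extended with a constant $\mathsf{f}$ (a generic point $\mathsf{N}\to\mathsf{N}_2$); $\overline{n}$ denotes $\mathsf{S}^n\,\mathsf{0}$. Evaluation contexts are $\mathbb{E} ::= [\;] \mid \mathbb{E}\,u \mid \mathbb{E}.1 \mid \mathbb{E}.2 \mid \mathsf{S}\,\mathbb{E} \mid \mathsf{f}\,\mathbb{E} \mid \mathsf{rec}_{\mathsf{N}_0}(\lambda x.C)\,\mathbb{E} \mid \mathsf{rec}_{\mathsf{N}_1}(\lambda x.C)\,a\,\mathbb{E} \mid \mathsf{rec}_{\mathsf{N}_2}(\lambda x.C)\,a_0\,a_1\,\mathbb{E} \mid \mathsf{rec}_{\mathsf{N}}(\lambda x.C)\,c_z\,g\,\mathbb{E}$.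 The unannotated one-step reduction $e\to e'$ consists of the $\beta$-rule, the projection rules $(u,v).1\to u$, $(u,v).2\to v$, and the $\iota$-rules for the recursors applied to $\mathsf{0}$, $\mathsf{1}$ or $\mathsf{S}\,\overline{k}$. The reduction $t\to_p u$ at condition $p$ is defined inductively: if $e\to e'$ then $e\to_p e'$; if $k\in\mathrm{dom}(p)$ then $\mathsf{f}\,\overline{k}\to_p p(k)$; and if $e\to_p e'$ then $\mathbb{E}[e]\to_p\mathbb{E}[e']$. This reduction is deterministic. -}

module Defs where

open import Data.Nat using (ℕ; zero; suc; _≤_; _<_; _⊔_; _≟_; _<ᵇ_)
open import Data.Nat.Properties using (≤-trans; m≤m⊔n; m≤n⊔m; <-irrefl)
open import Data.Bool using (Bool; true; false; if_then_else_)
open import Data.Maybe using (Maybe; just; nothing)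
open import Data.Product using (Σ; _,_; ∃)
open import Relation.Nullary using (yes; no)
open import Relation.Binary.PropositionalEquality using (_≡_; refl)

-- Conditions: finite partial functions ℕ ⇀ {0,1}
-- (Bool encodes {0,1}: false ↦ 0, true ↦ 1).  Finiteness is witnessed by
-- a bound beyond which the function is undefined.

record Cond : Set where
  field
    look  : ℕ → Maybe Bool
    bound : ℕ
    finite : ∀ n → bound ≤ n → look n ≡ nothing
open Cond public

_∈dom_ : ℕ → Cond → Set
k ∈dom p = ∃ λ b → look p k ≡ just b

_∉dom_ : ℕ → Cond → Set
m ∉dom p = look p m ≡ nothing

-- p(m ↦ b) = p ∪ {(m,b)}   (used only when m ∉ dom p)
extend : Cond → ℕ → Bool → Cond
extend p m b = record
  { look = λ n → lk n (n ≟ m)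
  ; bound = suc m ⊔ bound p
  ; finite = fin }
  where
  lk : (n : ℕ) → _ → Maybe Bool
  lk n (yes _) = just b
  lk n (no _)  = look p n
  fin : ∀ n → suc m ⊔ bound p ≤ n → lk n (n ≟ m) ≡ nothing
  fin n le with n ≟ m
  ... | yes refl = Data.Empty.⊥-elim (<-irrefl refl (≤-trans (m≤m⊔n (suc m) (bound p)) le))
    where import Data.Empty
  ... | no _ = finite p n (≤-trans (m≤n⊔m (suc m) (bound p)) le)

-- Raw terms (de Bruijn indices)

data Tm : Set where
  var  : ℕ → Tm
  lam  : Tm → Tm
  app  : Tm → Tm → Tm
  Pi   : Tm → Tm → Tm       -- Π (x : A) B  (B binds one variable)
  Sg   : Tm → Tm → Tm       -- Σ (x : A) B  (B binds one variable)
  pair : Tm → Tm → Tm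
  fst  : Tm → Tm
  snd  : Tm → Tm
  U    : Tm
  N N₀ N₁ N₂ : Tm
  zer  : Tm
  one  : Tm
  S    : Tm → Tm
  recN₀ recN₁ recN₂ recN : Tm
  f    : Tm                 -- the generic point f : N → N₂

num : ℕ → Tm
num zero    = zer
num (suc n) = S (num n)

bit : Bool → Tm
bit false = zer
bit true  = one

shift : ℕ → Tm → Tm
shift c (var i) = if i <ᵇ c then var i else var (suc i)
shift c (lam t) = lam (shift (suc c) t)
shift c (app t u) = app (shift c t) (shift c u)
shift c (Pi A B) = Pi (shift c A) (shift (suc c) B)
shift c (Sg A B) = Sg (shift c A) (shift (suc c) B)
shift c (pair t u) = pair (shift c t) (shift c u)
shift c (fst t) = fst (shift c t)
shift c (snd t) = snd (shift c t)
shift c U = U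
shift c N = N
shift c N₀ = N₀
shift c N₁ = N₁
shift c N₂ = N₂
shift c zer = zer
shift c one = one
shift c (S t) = S (shift c t)
shift c recN₀ = recN₀
shift c recN₁ = recN₁
shift c recN₂ = recN₂
shift c recN = recN
shift c f = f

subst : ℕ → Tm → Tm → Tm
subst j s (var i) with i ≟ j
... | yes _ = s
... | no _  = if i <ᵇ j then var i else var (Data.Nat.pred i)
subst j s (lam t) = lam (subst (suc j) (shift 0 s) t)
subst j s (app t u) = app (subst j s t) (subst j s u)
subst j s (Pi A B) = Pi (subst j s A) (subst (suc j) (shift 0 s) B)
subst j s (Sg A B) = Sg (subst j s A) (subst (suc j) (shift 0 s) B)
subst j s (pair t u) = pair (subst j s t) (subst j s u)
subst j s (fst t) = fst (subst j s t)
subst j s (snd t) = snd (subst j s t)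
subst j s U = U
subst j s N = N
subst j s N₀ = N₀
subst j s N₁ = N₁
subst j s N₂ = N₂
subst j s zer = zer
subst j s one = one
subst j s (S t) = S (subst j s t)
subst j s recN₀ = recN₀
subst j s recN₁ = recN₁
subst j s recN₂ = recN₂
subst j s recN = recN
subst j s f = f

_[_] : Tm → Tm → Tm
t [ u ] = subst 0 u t

data _⟶_ : Tm → Tm → Set where
  β      : ∀ t u → app (lam t) u ⟶ (t [ u ])
  π₁     : ∀ u v → fst (pair u v) ⟶ u
  π₂     : ∀ u v → snd (pair u v) ⟶ v
  ιN₁    : ∀ C a → app (app (app recN₁ (lam C)) a) zer ⟶ a
  ιN₂-0  : ∀ C a₀ a₁ → app (app (app (app recN₂ (lam C)) a₀) a₁) zer ⟶ a₀
  ιN₂-1  : ∀ C a₀ a₁ → app (app (app (app recN₂ (lam C)) a₀) a₁) one ⟶ a₁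
  ιN-0   : ∀ C cz g → app (app (app (app recN (lam C)) cz) g) zer ⟶ cz
  ιN-S   : ∀ C cz g k →
           app (app (app (app recN (lam C)) cz) g) (S (num k))
             ⟶ app (app g (num k)) (app (app (app (app recN (lam C)) cz) g) (num k))

data ECtx : Set where
  hole  : ECtx
  appE  : ECtx → Tm → ECtx
  fstE  : ECtx → ECtx
  sndE  : ECtx → ECtx
  SE    : ECtx → ECtx
  fE    : ECtx → ECtx
  recN₀E : Tm → ECtx → ECtx
  recN₁E : Tm → Tm → ECtx → ECtx
  recN₂E : Tm → Tm → Tm → ECtx → ECtx
  recNE  : Tm → Tm → Tm → ECtx → ECtx

plug : ECtx → Tm → Tm
plug hole e = e
plug (appE E u) e = app (plug E e) u
plug (fstE E) e = fst (plug E e)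
plug (sndE E) e = snd (plug E e)
plug (SE E) e = S (plug E e)
plug (fE E) e = app f (plug E e)
plug (recN₀E C E) e = app (app recN₀ (lam C)) (plug E e)
plug (recN₁E C a E) e = app (app (app recN₁ (lam C)) a) (plug E e)
plug (recN₂E C a₀ a₁ E) e = app (app (app (app recN₂ (lam C)) a₀) a₁) (plug E e)
plug (recNE C cz g E) e = app (app (app (app recN (lam C)) cz) g) (plug E e)

data _⊢_⟶_ (p : Cond) : Tm → Tm → Set where
  base : ∀ {e e'} → e ⟶ e' → p ⊢ e ⟶ e'
  gen  : ∀ {k b} → look p k ≡ just b → p ⊢ app f (num k) ⟶ bit b
  ctx  : ∀ {e e'} (E : ECtx) → p ⊢ e ⟶ e' → p ⊢ plug E e ⟶ plug E e'

-- A step at p(m ↦ b) either is already a step at p, or contracts the query f m̄ sitting in an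
-- evaluation context E, and then yields E[b].  Reduction at a fixed condition is deterministic
-- and plug E is injective.  So if u = v, the step to u cannot have used the query: otherwise
-- determinism at p(m ↦ 1) gives v = E[1] ≠ E[0] = u.  If u ≠ v, the two steps cannot both be
-- steps at p, so one of them exhibits t = E[f m̄].
module Submission where

open import Defs
open import Data.Nat using (ℕ; zero; suc; _≟_)
open import Data.Bool using (Bool; true; false)
open import Data.Product using (_×_; ∃; _,_)
open import Data.Sum using (_⊎_; inj₁; inj₂)
open import Data.Empty using (⊥-elim)
open import Data.Maybe using (just)
open import Relation.Nullary using (¬_; yes; no)
open import Relation.Binary.PropositionalEquality using (_≡_; _≢_; refl; sym; trans; cong)

private
  variable
    q : Cond
    k k′ : ℕ
    b : Bool
    n s s′ t t′ u v x : Tm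

-- Determinism is proved on a syntax-directed copy of _⊢_⟶_: neither plug E e nor num k is a
-- constructor pattern, so the evaluation context is unfolded into congruence rules and
-- numerals are described by the inductive predicate Numeral k n (meaning n ≡ num k).

data Numeral : ℕ → Tm → Set where
  num-zero : Numeral zero zer
  num-suc  : Numeral k n → Numeral (suc k) (S n)

numeral : ∀ k → Numeral k (num k)
numeral zero    = num-zero
numeral (suc k) = num-suc (numeral k)

Numeral-injective : Numeral k n → Numeral k′ n → k ≡ k′
Numeral-injective num-zero    num-zero    = refl
Numeral-injective (num-suc a) (num-suc b) = cong suc (Numeral-injective a b)

data _⊢_⇝_ (q : Cond) : Tm → Tm → Set where
  β     : ∀ t u → q ⊢ app (lam t) u ⇝ (t [ u ])
  π₁    : ∀ u v → q ⊢ fst (pair u v) ⇝ u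
  π₂    : ∀ u v → q ⊢ snd (pair u v) ⇝ v
  ιN₁   : ∀ C a → q ⊢ app (app (app recN₁ (lam C)) a) zer ⇝ a
  ιN₂-0 : ∀ C a₀ a₁ → q ⊢ app (app (app (app recN₂ (lam C)) a₀) a₁) zer ⇝ a₀
  ιN₂-1 : ∀ C a₀ a₁ → q ⊢ app (app (app (app recN₂ (lam C)) a₀) a₁) one ⇝ a₁
  ιN-0  : ∀ C cz g → q ⊢ app (app (app (app recN (lam C)) cz) g) zer ⇝ cz
  ιN-S  : ∀ C cz g → Numeral k n →
          q ⊢ app (app (app (app recN (lam C)) cz) g) (S n)
            ⇝ app (app g n) (app (app (app (app recN (lam C)) cz) g) n)
  gen   : Numeral k n → look q k ≡ just b → q ⊢ app f n ⇝ bit b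

data _⊢_↦_ (q : Cond) : Tm → Tm → Set where
  head     : q ⊢ t ⇝ t′ → q ⊢ t ↦ t′
  app-fun  : ∀ u → q ⊢ t ↦ t′ → q ⊢ app t u ↦ app t′ u
  fst-arg  : q ⊢ t ↦ t′ → q ⊢ fst t ↦ fst t′
  snd-arg  : q ⊢ t ↦ t′ → q ⊢ snd t ↦ snd t′
  S-arg    : q ⊢ t ↦ t′ → q ⊢ S t ↦ S t′
  f-arg    : q ⊢ t ↦ t′ → q ⊢ app f t ↦ app f t′
  recN₀-arg : ∀ C → q ⊢ t ↦ t′ →
              q ⊢ app (app recN₀ (lam C)) t ↦ app (app recN₀ (lam C)) t′
  recN₁-arg : ∀ C a → q ⊢ t ↦ t′ →
              q ⊢ app (app (app recN₁ (lam C)) a) t ↦ app (app (app recN₁ (lam C)) a) t′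
  recN₂-arg : ∀ C a₀ a₁ → q ⊢ t ↦ t′ →
              q ⊢ app (app (app (app recN₂ (lam C)) a₀) a₁) t
                ↦ app (app (app (app recN₂ (lam C)) a₀) a₁) t′
  recN-arg  : ∀ C cz g → q ⊢ t ↦ t′ →
              q ⊢ app (app (app (app recN (lam C)) cz) g) t
                ↦ app (app (app (app recN (lam C)) cz) g) t′

Numeral-irreducible : Numeral k n → ¬ (q ⊢ n ↦ x)
Numeral-irreducible num-zero    (head ())
Numeral-irreducible (num-suc a) (head ())
Numeral-irreducible (num-suc a) (S-arg d) = Numeral-irreducible a d

⇝-deterministic : q ⊢ t ⇝ u → q ⊢ t ⇝ v → u ≡ v
⇝-deterministic (β t u)          (β .t .u)          = refl
⇝-deterministic (π₁ u v)         (π₁ .u .v)         = refl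
⇝-deterministic (π₂ u v)         (π₂ .u .v)         = refl
⇝-deterministic (ιN₁ C a)        (ιN₁ .C .a)        = refl
⇝-deterministic (ιN₂-0 C a₀ a₁)  (ιN₂-0 .C .a₀ .a₁) = refl
⇝-deterministic (ιN₂-1 C a₀ a₁)  (ιN₂-1 .C .a₀ .a₁) = refl
⇝-deterministic (ιN-0 C cz g)    (ιN-0 .C .cz .g)   = refl
⇝-deterministic (ιN-S C cz g a)  (ιN-S .C .cz .g b) = refl
⇝-deterministic (gen a e) (gen a′ e′) with Numeral-injective a a′
... | refl with trans (sym e) e′
... | refl = refl

⇝-only-at-head : q ⊢ t ⇝ u → q ⊢ t ↦ v → q ⊢ t ⇝ v
⇝-only-at-head r (head r′) = r′
⇝-only-at-head (β _ _)         (app-fun _ (head ()))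
⇝-only-at-head (π₁ _ _)        (fst-arg (head ()))
⇝-only-at-head (π₂ _ _)        (snd-arg (head ()))
⇝-only-at-head (ιN₁ _ _)       (app-fun _ (app-fun _ (app-fun _ (head ()))))
⇝-only-at-head (ιN₁ _ _)       (recN₁-arg _ _ (head ()))
⇝-only-at-head (ιN₂-0 _ _ _)   (app-fun _ (app-fun _ (app-fun _ (app-fun _ (head ())))))
⇝-only-at-head (ιN₂-0 _ _ _)   (recN₂-arg _ _ _ (head ()))
⇝-only-at-head (ιN₂-1 _ _ _)   (app-fun _ (app-fun _ (app-fun _ (app-fun _ (head ())))))
⇝-only-at-head (ιN₂-1 _ _ _)   (recN₂-arg _ _ _ (head ()))
⇝-only-at-head (ιN-0 _ _ _)    (app-fun _ (app-fun _ (app-fun _ (app-fun _ (head ())))))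
⇝-only-at-head (ιN-0 _ _ _)    (recN-arg _ _ _ (head ()))
⇝-only-at-head (ιN-S _ _ _ _)  (app-fun _ (app-fun _ (app-fun _ (app-fun _ (head ())))))
⇝-only-at-head (ιN-S _ _ _ a)  (recN-arg _ _ _ d) = ⊥-elim (Numeral-irreducible (num-suc a) d)
⇝-only-at-head (gen _ _)       (app-fun _ (head ()))
⇝-only-at-head (gen a _)       (f-arg d) = ⊥-elim (Numeral-irreducible a d)

↦-deterministic : q ⊢ t ↦ u → q ⊢ t ↦ v → u ≡ v
↦-deterministic (head r) d = ⇝-deterministic r (⇝-only-at-head r d)
↦-deterministic d (head r) = sym (⇝-deterministic r (⇝-only-at-head r d))
↦-deterministic (app-fun u d) (app-fun .u d′) = cong (λ t → app t u) (↦-deterministic d d′)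
↦-deterministic (fst-arg d) (fst-arg d′) = cong fst (↦-deterministic d d′)
↦-deterministic (snd-arg d) (snd-arg d′) = cong snd (↦-deterministic d d′)
↦-deterministic (S-arg d)   (S-arg d′)   = cong S (↦-deterministic d d′)
↦-deterministic (f-arg d)   (f-arg d′)   = cong (app f) (↦-deterministic d d′)
↦-deterministic (recN₀-arg C d) (recN₀-arg .C d′) =
  cong (app (app recN₀ (lam C))) (↦-deterministic d d′)
↦-deterministic (recN₁-arg C a d) (recN₁-arg .C .a d′) =
  cong (app (app (app recN₁ (lam C)) a)) (↦-deterministic d d′)
↦-deterministic (recN₂-arg C a₀ a₁ d) (recN₂-arg .C .a₀ .a₁ d′) =
  cong (app (app (app (app recN₂ (lam C)) a₀) a₁)) (↦-deterministic d d′)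
↦-deterministic (recN-arg C cz g d) (recN-arg .C .cz .g d′) =
  cong (app (app (app (app recN (lam C)) cz) g)) (↦-deterministic d d′)
↦-deterministic (app-fun _ (head ())) (f-arg _)
↦-deterministic (app-fun _ (app-fun _ (head ()))) (recN₀-arg _ _)
↦-deterministic (app-fun _ (app-fun _ (app-fun _ (head ())))) (recN₁-arg _ _ _)
↦-deterministic (app-fun _ (app-fun _ (app-fun _ (app-fun _ (head ()))))) (recN₂-arg _ _ _ _)
↦-deterministic (app-fun _ (app-fun _ (app-fun _ (app-fun _ (head ()))))) (recN-arg _ _ _ _)
↦-deterministic (f-arg _) (app-fun _ (head ()))
↦-deterministic (recN₀-arg _ _) (app-fun _ (app-fun _ (head ())))
↦-deterministic (recN₁-arg _ _ _) (app-fun _ (app-fun _ (app-fun _ (head ()))))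
↦-deterministic (recN₂-arg _ _ _ _) (app-fun _ (app-fun _ (app-fun _ (app-fun _ (head ())))))
↦-deterministic (recN-arg _ _ _ _) (app-fun _ (app-fun _ (app-fun _ (app-fun _ (head ())))))

plug-↦ : ∀ E → q ⊢ t ↦ t′ → q ⊢ plug E t ↦ plug E t′
plug-↦ hole               d = d
plug-↦ (appE E u)         d = app-fun u (plug-↦ E d)
plug-↦ (fstE E)           d = fst-arg (plug-↦ E d)
plug-↦ (sndE E)           d = snd-arg (plug-↦ E d)
plug-↦ (SE E)             d = S-arg (plug-↦ E d)
plug-↦ (fE E)             d = f-arg (plug-↦ E d)
plug-↦ (recN₀E C E)       d = recN₀-arg C (plug-↦ E d)
plug-↦ (recN₁E C a E)     d = recN₁-arg C a (plug-↦ E d)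
plug-↦ (recN₂E C a₀ a₁ E) d = recN₂-arg C a₀ a₁ (plug-↦ E d)
plug-↦ (recNE C cz g E)   d = recN-arg C cz g (plug-↦ E d)

⟶⇒⇝ : t ⟶ t′ → q ⊢ t ⇝ t′
⟶⇒⇝ (β t u)           = β t u
⟶⇒⇝ (π₁ u v)          = π₁ u v
⟶⇒⇝ (π₂ u v)          = π₂ u v
⟶⇒⇝ (ιN₁ C a)         = ιN₁ C a
⟶⇒⇝ (ιN₂-0 C a₀ a₁)   = ιN₂-0 C a₀ a₁
⟶⇒⇝ (ιN₂-1 C a₀ a₁)   = ιN₂-1 C a₀ a₁
⟶⇒⇝ (ιN-0 C cz g)     = ιN-0 C cz g
⟶⇒⇝ (ιN-S C cz g k)   = ιN-S C cz g (numeral k)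

⊢⟶⇒↦ : q ⊢ t ⟶ t′ → q ⊢ t ↦ t′
⊢⟶⇒↦ (base s)         = head (⟶⇒⇝ s)
⊢⟶⇒↦ (gen {k} look≡b) = head (gen (numeral k) look≡b)
⊢⟶⇒↦ (ctx E d)        = plug-↦ E (⊢⟶⇒↦ d)

⊢⟶-deterministic : q ⊢ t ⟶ u → q ⊢ t ⟶ v → u ≡ v
⊢⟶-deterministic d d′ = ↦-deterministic (⊢⟶⇒↦ d) (⊢⟶⇒↦ d′)

_∘ᴱ_ : ECtx → ECtx → ECtx
hole               ∘ᴱ E′ = E′
appE E u           ∘ᴱ E′ = appE (E ∘ᴱ E′) u
fstE E             ∘ᴱ E′ = fstE (E ∘ᴱ E′)
sndE E             ∘ᴱ E′ = sndE (E ∘ᴱ E′)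
SE E               ∘ᴱ E′ = SE (E ∘ᴱ E′)
fE E               ∘ᴱ E′ = fE (E ∘ᴱ E′)
recN₀E C E         ∘ᴱ E′ = recN₀E C (E ∘ᴱ E′)
recN₁E C a E       ∘ᴱ E′ = recN₁E C a (E ∘ᴱ E′)
recN₂E C a₀ a₁ E   ∘ᴱ E′ = recN₂E C a₀ a₁ (E ∘ᴱ E′)
recNE C cz g E     ∘ᴱ E′ = recNE C cz g (E ∘ᴱ E′)

plug-∘ᴱ : ∀ E E′ t → plug E (plug E′ t) ≡ plug (E ∘ᴱ E′) t
plug-∘ᴱ hole               E′ t = refl
plug-∘ᴱ (appE E u)         E′ t = cong (λ s → app s u) (plug-∘ᴱ E E′ t)
plug-∘ᴱ (fstE E)           E′ t = cong fst (plug-∘ᴱ E E′ t)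
plug-∘ᴱ (sndE E)           E′ t = cong snd (plug-∘ᴱ E E′ t)
plug-∘ᴱ (SE E)             E′ t = cong S (plug-∘ᴱ E E′ t)
plug-∘ᴱ (fE E)             E′ t = cong (app f) (plug-∘ᴱ E E′ t)
plug-∘ᴱ (recN₀E C E)       E′ t = cong (app (app recN₀ (lam C))) (plug-∘ᴱ E E′ t)
plug-∘ᴱ (recN₁E C a E)     E′ t = cong (app (app (app recN₁ (lam C)) a)) (plug-∘ᴱ E E′ t)
plug-∘ᴱ (recN₂E C a₀ a₁ E) E′ t =
  cong (app (app (app (app recN₂ (lam C)) a₀) a₁)) (plug-∘ᴱ E E′ t)
plug-∘ᴱ (recNE C cz g E)   E′ t =
  cong (app (app (app (app recN (lam C)) cz) g)) (plug-∘ᴱ E E′ t)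

app-injectiveˡ : app s t ≡ app s′ t′ → s ≡ s′
app-injectiveˡ refl = refl

app-injectiveʳ : app s t ≡ app s′ t′ → t ≡ t′
app-injectiveʳ refl = refl

fst-injective : fst t ≡ fst t′ → t ≡ t′
fst-injective refl = refl

snd-injective : snd t ≡ snd t′ → t ≡ t′
snd-injective refl = refl

S-injective : S t ≡ S t′ → t ≡ t′
S-injective refl = refl

plug-injective : ∀ E → plug E t ≡ plug E t′ → t ≡ t′
plug-injective hole               eq = eq
plug-injective (appE E u)         eq = plug-injective E (app-injectiveˡ eq)
plug-injective (fstE E)           eq = plug-injective E (fst-injective eq)
plug-injective (sndE E)           eq = plug-injective E (snd-injective eq)
plug-injective (SE E)             eq = plug-injective E (S-injective eq)
plug-injective (fE E)             eq = plug-injective E (app-injectiveʳ eq)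
plug-injective (recN₀E C E)       eq = plug-injective E (app-injectiveʳ eq)
plug-injective (recN₁E C a E)     eq = plug-injective E (app-injectiveʳ eq)
plug-injective (recN₂E C a₀ a₁ E) eq = plug-injective E (app-injectiveʳ eq)
plug-injective (recNE C cz g E)   eq = plug-injective E (app-injectiveʳ eq)

extend-look-self : ∀ p m b → look (extend p m b) m ≡ just b
extend-look-self p m b with m ≟ m
... | yes _  = refl
... | no m≢m = ⊥-elim (m≢m refl)

AnswersQuery : ℕ → Bool → Tm → Tm → Set
AnswersQuery m b t u = ∃ λ E → t ≡ plug E (app f (num m)) × u ≡ plug E (bit b)

answer-query : ∀ p m b E → extend p m b ⊢ plug E (app f (num m)) ⟶ plug E (bit b)
answer-query p m b E = ctx E (gen (extend-look-self p m b))

extend-⟶-cases : ∀ {p m b} → extend p m b ⊢ t ⟶ u → (p ⊢ t ⟶ u) ⊎ AnswersQuery m b t u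
extend-⟶-cases (base s) = inj₁ (base s)
extend-⟶-cases {m = m} (gen {k} look≡b) with k ≟ m
... | no _ = inj₁ (gen look≡b)
... | yes refl with look≡b
...   | refl = inj₂ (hole , refl , refl)
extend-⟶-cases (ctx E d) with extend-⟶-cases d
... | inj₁ d′ = inj₁ (ctx E d′)
... | inj₂ (E′ , refl , refl) = inj₂ (E ∘ᴱ E′ , plug-∘ᴱ E E′ _ , plug-∘ᴱ E E′ _)

corollary2p3 : (p : Cond) (m : ℕ) → m ∉dom p → (t u v : Tm) →
    extend p m false ⊢ t ⟶ u → extend p m true ⊢ t ⟶ v →
    (u ≡ v → p ⊢ t ⟶ u) × (u ≢ v → ∃ λ E → t ≡ plug E (app f (num m)))
corollary2p3 p m _ t u v t⟶u t⟶v = equal , distinct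
  where
  equal : u ≡ v → p ⊢ t ⟶ u
  equal u≡v with extend-⟶-cases t⟶u
  ... | inj₁ t⟶ₚu = t⟶ₚu
  ... | inj₂ (E , refl , refl) with plug-injective E
          (trans u≡v (⊢⟶-deterministic t⟶v (answer-query p m true E)))
  ...   | ()

  distinct : u ≢ v → ∃ λ E → t ≡ plug E (app f (num m))
  distinct u≢v with extend-⟶-cases t⟶u | extend-⟶-cases t⟶v
  ... | inj₂ (E , t≡E[fm] , _) | _ = E , t≡E[fm]
  ... | inj₁ _ | inj₂ (E , t≡E[fm] , _) = E , t≡E[fm]
  ... | inj₁ t⟶ₚu | inj₁ t⟶ₚv = ⊥-elim (u≢v (⊢⟶-deterministic t⟶ₚu t⟶ₚv))
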